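{- Let $G=(V,E)$ be a graph and $k$ an integer. Let $\overline{\varphi}_G$ be the CNF formula over the variable set $\{x_v : v\in V\}$ given by the conjunction of the clauses $x_u\lor x_v$ over all edges $\{u,v\}\in E$. Then $G$ has an induced bipartite subgraph with at least $k$ vertices if and only if $\overline{\varphi}_G$ has two satisfying assignments $\alpha_1,\alpha_2$ with $|\alpha_1\triangle\alpha_2|\ge k$.
   Context: For truth assignments $\alpha_1,\alpha_2$ on a variable set $X$, $\alpha_1\triangle\alpha_2=\{x\in X:\alpha_1(x)\neq\alpha_2(x)\}$. -}

module Defs where

open import Data.Nat using (ℕ)
open import Data.Bool using (Bool; true; false; _xor_)
open import Data.Fin using (Fin)
open import Data.Fin.Subset using (Subset; _∈_; ∣_∣)
open import Data.Vec using (tabulate)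
open import Data.Sum using (_⊎_)
open import Data.Empty using (⊥)
open import Data.Product using (Σ)
open import Relation.Binary.PropositionalEquality using (_≡_; _≢_)
open import Level using (0ℓ; suc)

record Graph (n : ℕ) : Set₁ where
  field
    Adj   : Fin n → Fin n → Set
    sym   : ∀ {u v} → Adj u v → Adj v u
    irrefl : ∀ {u} → Adj u u → ⊥
open Graph public

Assignment : ℕ → Set
Assignment n = Fin n → Bool

-- α satisfies φ̄_G = ⋀_{{u,v} ∈ E} (x_u ∨ x_v).
Satisfies : ∀ {n} → Graph n → Assignment n → Set
Satisfies G α = ∀ u v → Adj G u v → (α u ≡ true) ⊎ (α v ≡ true)

_△_ : ∀ {n} → Assignment n → Assignment n → Subset n
α₁ △ α₂ = tabulate (λ x → α₁ x xor α₂ x)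

InducesBipartite : ∀ {n} → Graph n → Subset n → Set
InducesBipartite {n} G S =
  Σ (Fin n → Bool) (λ c → ∀ u v → u ∈ S → v ∈ S → Adj G u v → c u ≢ c v)

{-# OPTIONS --safe #-}
-- Two satisfying assignments of φ̄_G are vertex covers of G.  On an edge
-- inside α₁ △ α₂ they cannot agree on colour α₁, since then one of them
-- would leave the edge uncovered; so α₁ properly 2-colours G[α₁ △ α₂].
-- Conversely, from a proper 2-colouring c of G[S], set every vertex outside
-- S to true and use c, resp. its complement, on S: both are vertex covers,
-- and they differ exactly on S.
module Submission where

open import Defs hiding (sym)
open import Data.Nat using (ℕ)
open import Data.Integer using (ℤ; +_; _≤_)
open import Data.Bool using (Bool; true; false; not; _xor_; if_then_else_)
open import Data.Bool.Properties using (¬-not; not-injective)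
open import Data.Fin using (Fin)
open import Data.Fin.Subset using (Subset; ∣_∣; _∈_)
open import Data.Vec using (lookup)
open import Data.Vec.Properties
  using (lookup∘tabulate; tabulate-cong; tabulate∘lookup; []=⇒lookup; lookup⇒[]=)
open import Data.Product using (Σ; _×_; _,_; ∃₂)
open import Data.Sum using (_⊎_; inj₁; inj₂)
open import Function.Bundles using (_⇔_; mk⇔)
open import Relation.Binary.PropositionalEquality
  using (_≡_; _≢_; refl; sym; ≢-sym; trans; subst; module ≡-Reasoning)

covered-by-equal : ∀ {x y : Bool} → x ≡ y → x ≡ true ⊎ y ≡ true → x ≡ true
covered-by-equal _   (inj₁ x≡true) = x≡true
covered-by-equal x≡y (inj₂ y≡true) = trans x≡y y≡true

xor-or-not-xor : ∀ x b → x xor b ≡ true ⊎ not x xor b ≡ true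
xor-or-not-xor false false = inj₂ refl
xor-or-not-xor false true  = inj₁ refl
xor-or-not-xor true  false = inj₁ refl
xor-or-not-xor true  true  = inj₂ refl

≢⇒xor-one-true : ∀ {x y} b → x ≢ y → x xor b ≡ true ⊎ y xor b ≡ true
≢⇒xor-one-true {x} b x≢y rewrite ¬-not (≢-sym x≢y) = xor-or-not-xor x b

xor-complement : ∀ x → (x xor false) xor (x xor true) ≡ true
xor-complement false = refl
xor-complement true  = refl

xor≡true⇒≢ : ∀ {x y} → x xor y ≡ true → x ≢ y
xor≡true⇒≢ {false} () refl
xor≡true⇒≢ {true}  () refl

∈△⇒≢ : ∀ {n} (α₁ α₂ : Assignment n) {x} → x ∈ α₁ △ α₂ → α₁ x ≢ α₂ x
∈△⇒≢ α₁ α₂ {x} x∈△ =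
  xor≡true⇒≢ (trans (sym (lookup∘tabulate (λ y → α₁ y xor α₂ y) x)) ([]=⇒lookup x∈△))

module _ {n : ℕ} (G : Graph n) where

  △-inducesBipartite : ∀ {α₁ α₂} → Satisfies G α₁ → Satisfies G α₂ →
                       InducesBipartite G (α₁ △ α₂)
  △-inducesBipartite {α₁} {α₂} sat₁ sat₂ = α₁ , proper
    where
    open ≡-Reasoning
    proper : ∀ u v → u ∈ α₁ △ α₂ → v ∈ α₁ △ α₂ → Adj G u v → α₁ u ≢ α₁ v
    proper u v u∈ v∈ uv α₁u≡α₁v = ∈△⇒≢ α₁ α₂ u∈ (trans α₁u≡true (sym α₂u≡true))
      where
      α₂u≡α₂v : α₂ u ≡ α₂ v
      α₂u≡α₂v = not-injective (begin
        not (α₂ u) ≡⟨ ¬-not (∈△⇒≢ α₁ α₂ u∈) ⟨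
        α₁ u       ≡⟨ α₁u≡α₁v ⟩
        α₁ v       ≡⟨ ¬-not (∈△⇒≢ α₁ α₂ v∈) ⟩
        not (α₂ v) ∎)
      α₁u≡true : α₁ u ≡ true
      α₁u≡true = covered-by-equal α₁u≡α₁v (sat₁ u v uv)
      α₂u≡true : α₂ u ≡ true
      α₂u≡true = covered-by-equal α₂u≡α₂v (sat₂ u v uv)

  colourAssignment : Subset n → (Fin n → Bool) → Bool → Assignment n
  colourAssignment S c b x = if lookup S x then c x xor b else true

  colourAssignment-satisfies : ∀ {S} → ((c , _) : InducesBipartite G S) → ∀ b →
                               Satisfies G (colourAssignment S c b)
  colourAssignment-satisfies {S} (c , proper) b u v uv
    with lookup S u in u∈S | lookup S v in v∈S
  ... | false | _     = inj₁ refl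
  ... | true  | false = inj₂ refl
  ... | true  | true  =
    ≢⇒xor-one-true b (proper u v (lookup⇒[]= u S u∈S) (lookup⇒[]= v S v∈S) uv)

  colourAssignment-△ : ∀ S c →
                       colourAssignment S c false △ colourAssignment S c true ≡ S
  colourAssignment-△ S c = trans (tabulate-cong differ-on-S) (tabulate∘lookup S)
    where
    differ-on-S : ∀ x → colourAssignment S c false x xor colourAssignment S c true x
                        ≡ lookup S x
    differ-on-S x with lookup S x
    ... | false = refl
    ... | true  = xor-complement (c x)

  inducesBipartite⇒satisfying-△ : ∀ {S} → InducesBipartite G S →
    ∃₂ λ α₁ α₂ → Satisfies G α₁ × Satisfies G α₂ × α₁ △ α₂ ≡ S
  inducesBipartite⇒satisfying-△ {S} bip@(c , _) =
    colourAssignment S c false , colourAssignment S c true ,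
    colourAssignment-satisfies bip false , colourAssignment-satisfies bip true ,
    colourAssignment-△ S c

corollary1 : ∀ {n : ℕ} (G : Graph n) (k : ℤ) →
    (Σ (Subset n) (λ S → InducesBipartite G S × (k ≤ + ∣ S ∣)))
      ⇔ (Σ (Assignment n) (λ α₁ → Σ (Assignment n) (λ α₂ →
           Satisfies G α₁ × Satisfies G α₂ × (k ≤ + ∣ α₁ △ α₂ ∣))))
corollary1 G k = mk⇔
  (λ { (S , bip , k≤∣S∣) →
    let (α₁ , α₂ , sat₁ , sat₂ , α₁△α₂≡S) = inducesBipartite⇒satisfying-△ G bip
    in α₁ , α₂ , sat₁ , sat₂ , subst (λ T → k ≤ + ∣ T ∣) (sym α₁△α₂≡S) k≤∣S∣ })
  (λ { (α₁ , α₂ , sat₁ , sat₂ , k≤∣△∣) →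
    α₁ △ α₂ , △-inducesBipartite G sat₁ sat₂ , k≤∣△∣ })
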